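{- Let $L/K$ be an extension of number fields of degree $d\ge2$ with Galois closure $E$, $G=\mathrm{Gal}(E/K)$, and let $v$ be a non-archimedean place of $K$ with decomposition group $G_v$. Let $\Sigma(1)=\bigcup_{i=1}^l\Sigma_i(1)$ be the decomposition of the set of rays of $\Sigma$ into $G_v$-orbits, $d_i=\#\Sigma_i(1)$, and $u_1,\dots,u_l$ independent variables. Then $$Q_{\Sigma,v}(u_1,\dots,u_l)=1-u_1^{d_1}\cdots u_l^{d_l}.$$
   Context: Let $N_\omega=\prod_{i=0}^{d-1}l_i$ be the factorisation over $E$ of the norm form of a $K$-basis $\omega$ of $L$ into linear forms, permuted by $G$ via $g*l_i=l_{g(i)}$. Let $e_0,\dots,e_{d-1}$ be the elements of the rank $d-1$ lattice $X_*(\overline T)=\mathrm{Hom}(X^*(\overline T),\mathbb{Z})$, where $X^*(\overline T)=\{\prod l_i^{n_i}:\sum n_i=0\}$, given by $e_i(l_j/l_k)=\delta_{ij}-\delta_{ik}$; $G$ acts by $g*e_i=e_{g(i)}$. $\Sigma$ is the fan in $X_*(\overline T)\otimes\mathbb{R}$ whose $r$-dimensional cones are generated by the $r$-element subsets of $\{e_0,\dots,e_{d-1}\}$, $0\le r\le d-1$; $\Sigma(1)=\{\langle e_0\rangle,\dots,\langle e_{d-1}\rangle\}$ and $\Sigma^{G_v}$ is the set of $G_v$-invariant cones. For $\sigma\in\Sigma^{G_v}$ whose set of one-dimensional faces is $\Sigma_{i_1}(1)\cup\dots\cup\Sigma_{i_k}(1)$ put $R_{\sigma,v}=\prod_{j=1}^k\frac{u_{i_j}^{d_{i_j}}}{1-u_{i_j}^{d_{i_j}}}$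 (equal to $1$ for the zero cone), and define the polynomial $Q_{\Sigma,v}$ by $\frac{Q_{\Sigma,v}(u_1,\dots,u_l)}{\prod_{i=1}^l(1-u_i^{d_i})}=\sum_{\sigma\in\Sigma^{G_v}}R_{\sigma,v}(u_1,\dots,u_l)$. -}

module Defs where

open import Level using (Level)
open import Data.Nat as ℕ using (ℕ; zero; suc; _<ᵇ_)
open import Data.Fin as Fin using (Fin)
open import Data.Fin.Subset using (Subset; ∣_∣)
open import Data.Bool using (Bool; true; false; not; _∨_; _∧_; if_then_else_)
open import Data.List as List using (List; map; foldr; allFin; length; filter; _++_)
open import Data.List.Relation.Unary.Any using (Any)
open import Data.List.Membership.Propositional using (_∈_)
open import Data.Vec as Vec using (Vec; lookup)
open import Relation.Nullary using (does)
open import Relation.Binary.PropositionalEquality using (_≡_)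
open import Function.Definitions using (Injective)
open import Algebra.Bundles using (CommutativeRing)

-- A finite group of permutations of the index set {0,…,d-1} (the image of the
-- decomposition group G_v acting on the linear forms l_i, i.e. on the rays e_i).
-- A finite set of injective self-maps of Fin d containing the identity and
-- closed under composition is a subgroup of Sym(Fin d).
record FinitePermGroup (d : ℕ) : Set where
  field
    elems    : List (Fin d → Fin d)
    injectiv : ∀ {g} → g ∈ elems → Injective _≡_ _≡_ g
    hasId    : Any (λ g → ∀ i → g i ≡ i) elems
    closed   : ∀ {g h} → g ∈ elems → h ∈ elems →
               Any (λ k → ∀ i → k i ≡ g (h i)) elems

open FinitePermGroup public

allᵇ : {A : Set} → (A → Bool) → List A → Bool
allᵇ p = foldr (λ x b → p x ∧ b) true

allSubsets : (n : ℕ) → List (Subset n)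
allSubsets zero = List.[ Vec.[] ]
allSubsets (suc n) =
  map (true Vec.∷_) (allSubsets n) ++ map (false Vec.∷_) (allSubsets n)

isInvariantᵇ : {d : ℕ} → List (Fin d → Fin d) → Subset d → Bool
isInvariantᵇ {d} gs S =
  allᵇ (λ g → allᵇ (λ i → not (lookup S i) ∨ lookup S (g i)) (allFin d)) gs

-- The cone generated by {e_i : i ∈ S} lies in Σ iff |S| ≤ d-1, and it is
-- G_v-invariant iff S is invariant.
isInvariantConeᵇ : {d : ℕ} → List (Fin d → Fin d) → Subset d → Bool
isInvariantConeᵇ {d} gs S = isInvariantᵇ gs S ∧ (∣ S ∣ <ᵇ d)

orbitSize : {d l : ℕ} → (Fin d → Fin l) → Fin l → ℕ
orbitSize {d} o i = length (filter (λ j → o j Fin.≟ i) (allFin d))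

orbitInᵇ : {d l : ℕ} → (Fin d → Fin l) → Subset d → Fin l → Bool
orbitInᵇ {d} o S i = allᵇ (λ j → not (does (o j Fin.≟ i)) ∨ lookup S j) (allFin d)

module RingOps {c ℓ : Level} (R : CommutativeRing c ℓ) where
  open CommutativeRing R

  pow : Carrier → ℕ → Carrier
  pow x zero = 1#
  pow x (suc n) = x * pow x n

  prodL : List Carrier → Carrier
  prodL = foldr _*_ 1#

  sumL : List Carrier → Carrier
  sumL = foldr _+_ 0#

  -- R_{σ,v} with 1/(1 - u_i^{d_i}) represented by a given inverse w i.
  Rσ : {d l : ℕ} → (Fin d → Fin l) → (u w : Fin l → Carrier) → Subset d → Carrier
  Rσ {d} {l} o u w S =
    prodL (map (λ i → if orbitInᵇ o S i
                        then pow (u i) (orbitSize o i) * w i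
                        else 1#) (allFin l))

  coneSum : {d l : ℕ} → List (Fin d → Fin d) → (Fin d → Fin l) →
            (u w : Fin l → Carrier) → Carrier
  coneSum {d} gs o u w =
    sumL (map (λ S → if isInvariantConeᵇ gs S then Rσ o u w S else 0#)
              (allSubsets d))

{-# OPTIONS --safe #-}
-- A set of rays is G_v-invariant iff it is the preimage o⁻¹(T) of a set T of
-- orbits, and then R_{σ,v} = ∏_{i∈T} c_i with c_i = u_i^{d_i}/(1 - u_i^{d_i}).
-- Summing over all invariant sets therefore gives
-- Σ_T ∏_{i∈T} c_i = ∏_i (1 + c_i) = ∏_i 1/(1 - u_i^{d_i}).  Every invariant set
-- except the full set of rays has fewer than d elements and so spans a cone of
-- Σ; the full set contributes ∏_i c_i, and subtracting it leaves
-- (1 - ∏_i u_i^{d_i}) ∏_i 1/(1 - u_i^{d_i}).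
module Submission where

open import Defs
open import Level using (Level)
open import Data.Nat using (ℕ; _≤_)
open import Data.Fin using (Fin)
open import Data.List using (map; allFin)
open import Data.List.Relation.Unary.Any using (Any)
open import Data.Product using (∃)
open import Relation.Binary.PropositionalEquality using (_≡_)
open import Function.Bundles using (_⇔_)
open import Algebra.Bundles using (CommutativeRing)

open import Algebra.Bundles using (CommutativeMonoid; CommutativeSemiring)
open import Data.Bool using (Bool; true; false; not; _∨_; _∧_; if_then_else_)
open import Data.Bool.Properties using (∧-conicalˡ; ∧-conicalʳ; ∧-zeroʳ; ∧-identityʳ; ¬-not)
import Data.Bool.Properties as Boolₚ
open import Data.Nat using (zero; suc; _<?_)
open import Data.Nat.Properties using (n≮n; ≤∧≢⇒<)
import Data.Fin as Fin
open import Data.Fin.Subset using (Subset; inside; outside; ⊤; ∣_∣)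
open import Data.Fin.Subset.Properties using (∣⊤∣≡n; ∣p∣≤n; ∣p∣≡n⇒p≡⊤)
open import Data.List using (List; []; _∷_; _++_; tabulate)
import Data.List.Properties as Listₚ
open import Data.List.Relation.Unary.Any as Any using (here; there)
open import Data.List.Membership.Propositional using (_∈_; find)
open import Data.List.Membership.Propositional.Properties using (∈-allFin)
open import Data.Vec as Vec using (Vec; lookup)
import Data.Vec.Properties as Vecₚ
open import Data.Product using (_,_)
open import Function using (_∘_; case_of_; Injective)
open import Function.Bundles using (mk⇔; Equivalence)
open import Relation.Binary.PropositionalEquality as ≡ using (_≢_)
open import Relation.Nullary using (does; yes; no)
open import Relation.Nullary.Decidable using (dec-true; dec-false; does-⇔)
open import Relation.Binary.Definitions using (DecidableEquality)

open Equivalence using (to; from)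

_≟ˢ_ : ∀ {n} → DecidableEquality (Subset n)
_≟ˢ_ = Vecₚ.≡-dec Boolₚ._≟_

module SubsetSum {c ℓ} (M : CommutativeMonoid c ℓ) where
  open CommutativeMonoid M
    renaming (_∙_ to _+_; ε to 0#; ∙-cong to +-cong; identityˡ to +-identityˡ; identityʳ to +-identityʳ)
  open import Relation.Binary.Reasoning.Setoid setoid
  open import Algebra.Properties.CommutativeSemigroup commutativeSemigroup using (interchange)

  ΣS : (n : ℕ) → (Subset n → Carrier) → Carrier
  ΣS zero    f = f Vec.[]
  ΣS (suc n) f = ΣS n (λ S → f (inside Vec.∷ S)) + ΣS n (λ S → f (outside Vec.∷ S))

  ΣS↾ : (n : ℕ) → (Subset n → Bool) → (Subset n → Carrier) → Carrier
  ΣS↾ n P f = ΣS n (λ S → if P S then f S else 0#)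

  ΣS-cong : ∀ n {f g : Subset n → Carrier} → (∀ S → f S ≈ g S) → ΣS n f ≈ ΣS n g
  ΣS-cong zero    f≈g = f≈g Vec.[]
  ΣS-cong (suc n) f≈g = +-cong (ΣS-cong n (f≈g ∘ (inside Vec.∷_))) (ΣS-cong n (f≈g ∘ (outside Vec.∷_)))

  ΣS-zero : ∀ n → ΣS n (λ _ → 0#) ≈ 0#
  ΣS-zero zero    = refl
  ΣS-zero (suc n) = trans (+-cong (ΣS-zero n) (ΣS-zero n)) (+-identityˡ 0#)

  ΣS-distrib-+ : ∀ n (f g : Subset n → Carrier) → ΣS n (λ S → f S + g S) ≈ ΣS n f + ΣS n g
  ΣS-distrib-+ zero    f g = refl
  ΣS-distrib-+ (suc n) f g =
    trans (+-cong (ΣS-distrib-+ n _ _) (ΣS-distrib-+ n _ _)) (interchange _ _ _ _)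

  ΣS-comm : ∀ m n (h : Subset m → Subset n → Carrier) →
            ΣS m (λ S → ΣS n (h S)) ≈ ΣS n (λ T → ΣS m (λ S → h S T))
  ΣS-comm zero    n h = refl
  ΣS-comm (suc m) n h = begin
    ΣS m (λ S → ΣS n (h (inside Vec.∷ S))) + ΣS m (λ S → ΣS n (h (outside Vec.∷ S)))
      ≈⟨ +-cong (ΣS-comm m n _) (ΣS-comm m n _) ⟩
    ΣS n (λ T → ΣS m (λ S → h (inside Vec.∷ S) T)) + ΣS n (λ T → ΣS m (λ S → h (outside Vec.∷ S) T))
      ≈⟨ ΣS-distrib-+ n _ _ ⟨
    ΣS n (λ T → ΣS (suc m) (λ S → h S T)) ∎

  ΣS↾-point : ∀ n (X : Subset n) (f : Subset n → Carrier) → ΣS↾ n (λ S → does (X ≟ˢ S)) f ≈ f X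
  ΣS↾-point zero    Vec.[]            f = refl
  ΣS↾-point (suc n) (inside Vec.∷ X)  f = trans (+-cong (ΣS↾-point n X _) (ΣS-zero n)) (+-identityʳ _)
  ΣS↾-point (suc n) (outside Vec.∷ X) f = trans (+-cong (ΣS-zero n) (ΣS↾-point n X _)) (+-identityˡ _)

  ΣS↾-insert : ∀ n (X : Subset n) {P Q : Subset n → Bool} → Q X ≡ false → P X ≡ true →
               (∀ S → S ≢ X → Q S ≡ P S) →
               (f : Subset n → Carrier) → ΣS↾ n Q f + f X ≈ ΣS↾ n P f
  ΣS↾-insert n X {P} {Q} QX PX Q≡P f = begin
    ΣS↾ n Q f + f X                              ≈⟨ +-cong refl (ΣS↾-point n X f) ⟨
    ΣS↾ n Q f + ΣS↾ n (λ S → does (X ≟ˢ S)) f    ≈⟨ ΣS-distrib-+ n _ _ ⟨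
    ΣS n (λ S → (if Q S then f S else 0#) + (if does (X ≟ˢ S) then f S else 0#))
                                                 ≈⟨ ΣS-cong n split ⟩
    ΣS↾ n P f                                    ∎
    where
    split : ∀ S → (if Q S then f S else 0#) + (if does (X ≟ˢ S) then f S else 0#)
                  ≈ (if P S then f S else 0#)
    split S with X ≟ˢ S
    ... | yes ≡.refl rewrite QX | PX = +-identityˡ _
    ... | no X≢S rewrite Q≡P S (X≢S ∘ ≡.sym) = +-identityʳ _

  ΣS↾-reindex : ∀ {m n} {φ : Subset m → Subset n} → Injective _≡_ _≡_ φ →
                (P : Subset n → Bool) → (∀ T → P (φ T) ≡ true) →
                (∀ S → P S ≡ true → ∃ λ T → φ T ≡ S) →
                (f : Subset n → Carrier) → ΣS↾ n P f ≈ ΣS m (f ∘ φ)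
  ΣS↾-reindex {m} {n} {φ} φ-injective P P-image image-P f = begin
    ΣS↾ n P f                                                 ≈⟨ ΣS-cong n fibre ⟩
    ΣS n (λ S → ΣS↾ m (λ T → does (φ T ≟ˢ S)) (λ _ → f S))   ≈⟨ ΣS-comm n m _ ⟩
    ΣS m (λ T → ΣS↾ n (λ S → does (φ T ≟ˢ S)) f)             ≈⟨ ΣS-cong m (λ T → ΣS↾-point n (φ T) f) ⟩
    ΣS m (f ∘ φ)                                              ∎
    where
    fibre-of-image : ∀ T₀ x → ΣS↾ m (λ T → does (φ T ≟ˢ φ T₀)) (λ _ → x) ≈ x
    fibre-of-image T₀ x = trans (ΣS-cong m same-test) (ΣS↾-point m T₀ (λ _ → x))
      where
      same-test : ∀ T → (if does (φ T ≟ˢ φ T₀) then x else 0#) ≈ (if does (T₀ ≟ˢ T) then x else 0#)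
      same-test T = reflexive (≡.cong (λ b → if b then x else 0#)
        (does-⇔ (mk⇔ (≡.sym ∘ φ-injective) (≡.cong φ ∘ ≡.sym)) (φ T ≟ˢ φ T₀) (T₀ ≟ˢ T)))

    fibre : ∀ S → (if P S then f S else 0#) ≈ ΣS↾ m (λ T → does (φ T ≟ˢ S)) (λ _ → f S)
    fibre S with P S in PS
    ... | true with image-P S PS
    ...   | T₀ , ≡.refl = sym (fibre-of-image T₀ (f (φ T₀)))
    fibre S | false = sym (trans (ΣS-cong m outside-image) (ΣS-zero m))
      where
      outside-image : ∀ T → (if does (φ T ≟ˢ S) then f S else 0#) ≈ 0#
      outside-image T with φ T ≟ˢ S
      ... | no _ = refl
      ... | yes ≡.refl with ≡.trans (≡.sym (P-image T)) PS
      ...   | ()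

module SubsetProductExpansion {c ℓ} (R : CommutativeSemiring c ℓ) where
  open CommutativeSemiring R
  open SubsetSum +-commutativeMonoid public
  open import Algebra.Properties.CommutativeMonoid.Sum *-commutativeMonoid using () renaming (sum to ∏)
  open import Relation.Binary.Reasoning.Setoid setoid

  ΣS-*ˡ : ∀ n x (f : Subset n → Carrier) → ΣS n (λ S → x * f S) ≈ x * ΣS n f
  ΣS-*ˡ zero    x f = refl
  ΣS-*ˡ (suc n) x f = trans (+-cong (ΣS-*ˡ n x _) (ΣS-*ˡ n x _)) (sym (distribˡ x _ _))

  ∏-1+≈ΣS-∏ : ∀ n (x : Fin n → Carrier) →
              ∏ (λ i → 1# + x i) ≈ ΣS n (λ T → ∏ (λ i → if lookup T i then x i else 1#))
  ∏-1+≈ΣS-∏ zero    x = refl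
  ∏-1+≈ΣS-∏ (suc n) x = begin
    (1# + x₀) * ∏ (λ i → 1# + x (Fin.suc i))      ≈⟨ *-congˡ (∏-1+≈ΣS-∏ n (x ∘ Fin.suc)) ⟩
    (1# + x₀) * ΣS n Π                             ≈⟨ distribʳ _ _ _ ⟩
    1# * ΣS n Π + x₀ * ΣS n Π                      ≈⟨ +-comm _ _ ⟩
    x₀ * ΣS n Π + 1# * ΣS n Π                      ≈⟨ +-cong (ΣS-*ˡ n _ Π) (ΣS-*ˡ n _ Π) ⟨
    ΣS n (λ T → x₀ * Π T) + ΣS n (λ T → 1# * Π T)  ∎
    where
    x₀ : Carrier
    x₀ = x Fin.zero
    Π : Subset n → Carrier
    Π T = ∏ (λ i → if lookup T i then x (Fin.suc i) else 1#)

module CommutativeRingFacts {c ℓ} (R : CommutativeRing c ℓ) where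
  open CommutativeRing R
  open RingOps R
  open SubsetProductExpansion commutativeSemiring public
  open import Algebra.Properties.CommutativeMonoid.Sum *-commutativeMonoid public
    using () renaming (sum to ∏; sum-cong-≋ to ∏-cong; ∑-distrib-+ to ∏-distrib-*)
  open import Algebra.Properties.Ring ring using (-‿distribˡ-*)
  open import Relation.Binary.Reasoning.Setoid setoid

  sumL-++ : ∀ xs ys → sumL (xs ++ ys) ≈ sumL xs + sumL ys
  sumL-++ []       ys = sym (+-identityˡ _)
  sumL-++ (x ∷ xs) ys = trans (+-congˡ (sumL-++ xs ys)) (sym (+-assoc _ _ _))

  sumL-allSubsets : ∀ n (f : Subset n → Carrier) → sumL (map f (allSubsets n)) ≈ ΣS n f
  sumL-allSubsets zero    f = +-identityʳ _
  sumL-allSubsets (suc n) f = begin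
    sumL (map f (map (inside Vec.∷_) Ss ++ map (outside Vec.∷_) Ss))
      ≡⟨ ≡.cong sumL (Listₚ.map-++ f (map (inside Vec.∷_) Ss) _) ⟩
    sumL (map f (map (inside Vec.∷_) Ss) ++ map f (map (outside Vec.∷_) Ss))
      ≈⟨ sumL-++ (map f (map (inside Vec.∷_) Ss)) _ ⟩
    sumL (map f (map (inside Vec.∷_) Ss)) + sumL (map f (map (outside Vec.∷_) Ss))
      ≡⟨ ≡.cong₂ _+_ (≡.cong sumL (Listₚ.map-∘ Ss)) (≡.cong sumL (Listₚ.map-∘ Ss)) ⟨
    sumL (map (λ S → f (inside Vec.∷ S)) Ss) + sumL (map (λ S → f (outside Vec.∷ S)) Ss)
      ≈⟨ +-cong (sumL-allSubsets n _) (sumL-allSubsets n _) ⟩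
    ΣS (suc n) f ∎
    where
    Ss : List (Subset n)
    Ss = allSubsets n

  prodL-tabulate : ∀ n (f : Fin n → Carrier) → prodL (tabulate f) ≡ ∏ f
  prodL-tabulate zero    f = ≡.refl
  prodL-tabulate (suc n) f = ≡.cong (f Fin.zero *_) (prodL-tabulate n (f ∘ Fin.suc))

  prodL-allFin : ∀ {n} (f : Fin n → Carrier) → prodL (map f (allFin n)) ≈ ∏ f
  prodL-allFin {n} f =
    reflexive (≡.trans (≡.cong prodL (Listₚ.map-tabulate (λ i → i) f)) (prodL-tabulate n f))

  z*[1-y]≈1⇒1+y*z≈z : ∀ {y z} → z * (1# - y) ≈ 1# → 1# + y * z ≈ z
  z*[1-y]≈1⇒1+y*z≈z {y} {z} z*[1-y]≈1 = begin
    1# + y * z                      ≈⟨ +-cong z*[1-y]≈1 (*-comm z y) ⟨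
    z * (1# - y) + z * y            ≈⟨ distribˡ z (1# - y) y ⟨
    z * ((1# - y) + y)              ≈⟨ *-congˡ (trans (+-assoc 1# (- y) y) (+-congˡ (-‿inverseˡ y))) ⟩
    z * (1# + 0#)                   ≈⟨ *-congˡ (+-identityʳ 1#) ⟩
    z * 1#                          ≈⟨ *-identityʳ z ⟩
    z                               ∎

  x+y*z≈z⇒x≈[1-y]*z : ∀ {x y z} → x + y * z ≈ z → x ≈ (1# - y) * z
  x+y*z≈z⇒x≈[1-y]*z {x} {y} {z} x+y*z≈z = begin
    x                               ≈⟨ +-identityʳ x ⟨
    x + 0#                          ≈⟨ +-congˡ (-‿inverseʳ (y * z)) ⟨
    x + (y * z - y * z)             ≈⟨ +-assoc x (y * z) _ ⟨
    (x + y * z) - y * z             ≈⟨ +-cong x+y*z≈z (-‿distribˡ-* y z) ⟩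
    z + (- y) * z                   ≈⟨ +-congʳ (*-identityˡ z) ⟨
    1# * z + (- y) * z              ≈⟨ distribʳ z 1# (- y) ⟨
    (1# - y) * z                    ∎

allᵇ≡true⇔ : {A : Set} (p : A → Bool) (xs : List A) →
             allᵇ p xs ≡ true ⇔ (∀ {x} → x ∈ xs → p x ≡ true)
allᵇ≡true⇔ p xs = mk⇔ (allᵇ⇒ xs) (⇒allᵇ xs)
  where
  allᵇ⇒ : ∀ xs → allᵇ p xs ≡ true → ∀ {x} → x ∈ xs → p x ≡ true
  allᵇ⇒ (y ∷ ys) all-p (here ≡.refl) = ∧-conicalˡ _ _ all-p
  allᵇ⇒ (y ∷ ys) all-p (there x∈ys)  = allᵇ⇒ ys (∧-conicalʳ _ _ all-p) x∈ys
  ⇒allᵇ : ∀ xs → (∀ {x} → x ∈ xs → p x ≡ true) → allᵇ p xs ≡ true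
  ⇒allᵇ []       _     = ≡.refl
  ⇒allᵇ (y ∷ ys) all-p = ≡.cong₂ _∧_ (all-p (here ≡.refl)) (⇒allᵇ ys (all-p ∘ there))

allᵇ-allFin≡true⇔ : ∀ {n} (p : Fin n → Bool) → allᵇ p (allFin n) ≡ true ⇔ (∀ i → p i ≡ true)
allᵇ-allFin≡true⇔ {n} p = mk⇔ (λ all-p i → to (allᵇ≡true⇔ p (allFin n)) all-p (∈-allFin i))
                             (λ all-p → from (allᵇ≡true⇔ p (allFin n)) (λ {i} _ → all-p i))

not∨≡true⇔ : ∀ a b → (not a ∨ b) ≡ true ⇔ (a ≡ true → b ≡ true)
not∨≡true⇔ false b = mk⇔ (λ _ ()) (λ _ → ≡.refl)
not∨≡true⇔ true  b = mk⇔ (λ b≡true _ → b≡true) (λ a⇒b → a⇒b ≡.refl)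

lookup-ext : ∀ {A : Set} {n} {xs ys : Vec A n} → (∀ i → lookup xs i ≡ lookup ys i) → xs ≡ ys
lookup-ext {xs = xs} {ys} xs≗ys =
  ≡.trans (≡.sym (Vecₚ.tabulate∘lookup xs)) (≡.trans (Vecₚ.tabulate-cong xs≗ys) (Vecₚ.tabulate∘lookup ys))

module _ {d : ℕ} (gs : List (Fin d → Fin d)) where

  isInvariantᵇ≡true⇔ : ∀ S → isInvariantᵇ gs S ≡ true ⇔
                       (∀ {g} → g ∈ gs → ∀ i → lookup S i ≡ true → lookup S (g i) ≡ true)
  isInvariantᵇ≡true⇔ S = mk⇔
    (λ inv {g} g∈gs i → to (not∨≡true⇔ _ _) (to (stays-everywhere g) (to (allᵇ≡true⇔ _ gs) inv g∈gs) i))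
    (λ inv → from (allᵇ≡true⇔ _ gs) λ {g} g∈gs →
               from (stays-everywhere g) λ i → from (not∨≡true⇔ _ _) (inv g∈gs i))
    where
    stays-everywhere : ∀ g → allᵇ (λ i → not (lookup S i) ∨ lookup S (g i)) (allFin d) ≡ true ⇔
                             (∀ i → (not (lookup S i) ∨ lookup S (g i)) ≡ true)
    stays-everywhere g = allᵇ-allFin≡true⇔ _

  isInvariant-⊤ : isInvariantᵇ gs ⊤ ≡ true
  isInvariant-⊤ = from (isInvariantᵇ≡true⇔ ⊤) (λ {g} _ i _ → Vecₚ.lookup-replicate (g i) true)

  isInvariantCone-⊤ : isInvariantConeᵇ gs ⊤ ≡ false
  isInvariantCone-⊤ rewrite ∣⊤∣≡n d | dec-false (d <? d) (n≮n d) = ∧-zeroʳ _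

  isInvariantCone-≢⊤ : ∀ S → S ≢ ⊤ → isInvariantConeᵇ gs S ≡ isInvariantᵇ gs S
  isInvariantCone-≢⊤ S S≢⊤
    rewrite dec-true (∣ S ∣ <? d) (≤∧≢⇒< (∣p∣≤n S) (S≢⊤ ∘ ∣p∣≡n⇒p≡⊤)) = ∧-identityʳ _

module OrbitLabelling {d l : ℕ} (o : Fin d → Fin l) where

  preimage : Subset l → Subset d
  preimage T = Vec.tabulate (lookup T ∘ o)

  orbitsIn : Subset d → Subset l
  orbitsIn S = Vec.tabulate (orbitInᵇ o S)

  lookup-preimage : ∀ T j → lookup (preimage T) j ≡ lookup T (o j)
  lookup-preimage T = Vecₚ.lookup∘tabulate (lookup T ∘ o)

  orbitInᵇ≡true⇔ : ∀ S i → orbitInᵇ o S i ≡ true ⇔ (∀ j → o j ≡ i → lookup S j ≡ true)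
  orbitInᵇ≡true⇔ S i = mk⇔
    (λ orbit-in j oj≡i →
       to (not∨≡true⇔ _ _) (to (allᵇ-allFin≡true⇔ _) orbit-in j) (dec-true (o j Fin.≟ i) oj≡i))
    (λ in-S → from (allᵇ-allFin≡true⇔ _) (in-orbit⇒in-S in-S))
    where
    in-orbit⇒in-S : (∀ j → o j ≡ i → lookup S j ≡ true) →
                    ∀ j → (not (does (o j Fin.≟ i)) ∨ lookup S j) ≡ true
    in-orbit⇒in-S in-S j with o j Fin.≟ i
    ... | yes oj≡i = in-S j oj≡i
    ... | no  _    = ≡.refl

  orbitIn-⊤ : ∀ i → orbitInᵇ o ⊤ i ≡ true
  orbitIn-⊤ i = from (orbitInᵇ≡true⇔ ⊤ i) (λ j _ → Vecₚ.lookup-replicate j true)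

  module _ (surjective : ∀ i → ∃ λ j → o j ≡ i) where

    preimage-injective : Injective _≡_ _≡_ preimage
    preimage-injective {T} {T′} preimages-equal = lookup-ext same-lookup
      where
      same-lookup : ∀ i → lookup T i ≡ lookup T′ i
      same-lookup i with surjective i
      ... | j , ≡.refl = ≡.trans (≡.sym (lookup-preimage T j))
                           (≡.trans (≡.cong (λ S → lookup S j) preimages-equal) (lookup-preimage T′ j))

    orbitIn-preimage : ∀ T i → orbitInᵇ o (preimage T) i ≡ lookup T i
    orbitIn-preimage T i with lookup T i in Ti
    ... | true  = from (orbitInᵇ≡true⇔ (preimage T) i)
                    (λ j oj≡i → ≡.trans (lookup-preimage T j) (≡.trans (≡.cong (lookup T) oj≡i) Ti))
    ... | false with surjective i
    ...   | j , ≡.refl = ¬-not λ orbit-in → case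
                           ≡.trans (≡.sym (to (orbitInᵇ≡true⇔ (preimage T) (o j)) orbit-in j ≡.refl))
                                   (≡.trans (lookup-preimage T j) Ti) of λ ()

  module _ (gs : List (Fin d → Fin d)) where

    preimage-isInvariant : (∀ {g} → g ∈ gs → ∀ i → o (g i) ≡ o i) → ∀ T → isInvariantᵇ gs (preimage T) ≡ true
    preimage-isInvariant o-constant T = from (isInvariantᵇ≡true⇔ gs (preimage T)) λ {g} g∈gs i Ti →
      ≡.trans (lookup-preimage T (g i))
        (≡.trans (≡.cong (lookup T) (o-constant g∈gs i)) (≡.trans (≡.sym (lookup-preimage T i)) Ti))

    isInvariant⇒preimage : (∀ i j → o i ≡ o j → Any (λ g → g i ≡ j) gs) →
                           ∀ S → isInvariantᵇ gs S ≡ true → preimage (orbitsIn S) ≡ S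
    isInvariant⇒preimage fibres-are-orbits S invariant = lookup-ext λ j →
      ≡.trans (lookup-preimage (orbitsIn S) j)
        (≡.trans (Vecₚ.lookup∘tabulate (orbitInᵇ o S) (o j)) (orbit-of-member j))
      where
      orbit-of-member : ∀ j → orbitInᵇ o S (o j) ≡ lookup S j
      orbit-of-member j with lookup S j in Sj
      ... | true  = from (orbitInᵇ≡true⇔ S (o j)) λ k ok≡oj →
                      let g , g∈gs , gj≡k = find (fibres-are-orbits j k (≡.sym ok≡oj))
                      in ≡.subst (λ x → lookup S x ≡ true) gj≡k
                           (to (isInvariantᵇ≡true⇔ gs S) invariant g∈gs j Sj)
      ... | false = ¬-not λ orbit-in →
                      case ≡.trans (≡.sym (to (orbitInᵇ≡true⇔ S (o j)) orbit-in j ≡.refl)) Sj of λ ()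

proposition3p6 : {c ℓ : Level} (d l : ℕ) → 2 ≤ d →
    (Gv : FinitePermGroup d) →
    (o : Fin d → Fin l) →
    (∀ i → ∃ λ j → o j ≡ i) →
    (∀ i j → (o i ≡ o j) ⇔ Any (λ g → g i ≡ j) (elems Gv)) →
    (R : CommutativeRing c ℓ) →
    (u w : Fin l → CommutativeRing.Carrier R) →
    (∀ i → CommutativeRing._≈_ R
             (CommutativeRing._*_ R (w i)
               (CommutativeRing._-_ R (CommutativeRing.1# R)
                 (RingOps.pow R (u i) (orbitSize o i))))
             (CommutativeRing.1# R)) →
    CommutativeRing._≈_ R
      (RingOps.coneSum R (elems Gv) o u w)
      (CommutativeRing._*_ R
        (CommutativeRing._-_ R (CommutativeRing.1# R)
          (RingOps.prodL R (map (λ i → RingOps.pow R (u i) (orbitSize o i)) (allFin l))))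
        (RingOps.prodL R (map w (allFin l))))
proposition3p6 d l _ Gv o surjective orbits R u w w-inverts =
  x+y*z≈z⇒x≈[1-y]*z (begin
    coneSum gs o u w + prodL (map a (allFin l)) * prodL (map w (allFin l))
      ≈⟨ +-cong (sumL-allSubsets d _) (trans (*-cong (prodL-allFin a) (prodL-allFin w)) (sym Rs-⊤)) ⟩
    ΣS↾ d (isInvariantConeᵇ gs) Rs + Rs ⊤
      ≈⟨ ΣS↾-insert d ⊤ (isInvariantCone-⊤ gs) (isInvariant-⊤ gs) (isInvariantCone-≢⊤ gs) Rs ⟩
    ΣS↾ d (isInvariantᵇ gs) Rs
      ≈⟨ ΣS↾-reindex (preimage-injective surjective) (isInvariantᵇ gs)
           (preimage-isInvariant gs o-constant) invariant⇒image Rs ⟩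
    ΣS l (Rs ∘ preimage)
      ≈⟨ ΣS-cong l Rs-preimage ⟩
    ΣS l (λ T → ∏ (λ i → if lookup T i then a i * w i else 1#))
      ≈⟨ ∏-1+≈ΣS-∏ l (λ i → a i * w i) ⟨
    ∏ (λ i → 1# + a i * w i)
      ≈⟨ ∏-cong (λ i → z*[1-y]≈1⇒1+y*z≈z (w-inverts i)) ⟩
    ∏ w
      ≈⟨ prodL-allFin w ⟨
    prodL (map w (allFin l)) ∎)
  where
  open CommutativeRing R
  open RingOps R
  open CommutativeRingFacts R
  open OrbitLabelling o
  open import Relation.Binary.Reasoning.Setoid setoid

  gs : List (Fin d → Fin d)
  gs = elems Gv
  a : Fin l → Carrier
  a i = pow (u i) (orbitSize o i)
  Rs : Subset d → Carrier
  Rs = Rσ o u w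

  o-constant : ∀ {g} → g ∈ gs → ∀ i → o (g i) ≡ o i
  o-constant g∈gs i = ≡.sym (from (orbits i _) (Any.map (λ g≡ → ≡.cong (λ h → h i) (≡.sym g≡)) g∈gs))

  invariant⇒image : ∀ S → isInvariantᵇ gs S ≡ true → ∃ λ T → preimage T ≡ S
  invariant⇒image S invariant = orbitsIn S , isInvariant⇒preimage gs (λ i j → to (orbits i j)) S invariant

  Rs-as-∏ : ∀ S → Rs S ≈ ∏ (λ i → if orbitInᵇ o S i then a i * w i else 1#)
  Rs-as-∏ S = prodL-allFin (λ i → if orbitInᵇ o S i then a i * w i else 1#)

  Rs-preimage : ∀ T → Rs (preimage T) ≈ ∏ (λ i → if lookup T i then a i * w i else 1#)
  Rs-preimage T = trans (Rs-as-∏ (preimage T)) (∏-cong λ i →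
    reflexive (≡.cong (λ b → if b then a i * w i else 1#) (orbitIn-preimage surjective T i)))

  Rs-⊤ : Rs ⊤ ≈ ∏ a * ∏ w
  Rs-⊤ = trans (Rs-as-∏ ⊤) (trans (∏-cong λ i →
    reflexive (≡.cong (λ b → if b then a i * w i else 1#) (orbitIn-⊤ i))) (∏-distrib-* a w))
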